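{- For $p\in\{120,101\}$, we have $$C_p(x,y)=\frac{1-2x+x^2-x^2y}{1-3x+2x^2-x^2y}.$$
   Context: A Catalan word of length $n\geq 1$ is a word $w_1\ldots w_n$ over the non-negative integers with $w_1=0$ and $0\leq w_i\leq w_{i-1}+1$ for $2\leq i\leq n$; the empty word is the unique Catalan word of length $0$. A word $w$ contains the pattern $p=p_1\ldots p_k$ if there are indices $i_1<\cdots<i_k$ such that $w_{i_1}\ldots w_{i_k}$ is order-isomorphic to $p$ (for all $a,b$: $w_{i_a}<w_{i_b}$ iff $p_a<p_b$, and $w_{i_a}=w_{i_b}$ iff $p_a=p_b$); otherwise $w$ avoids $p$. $\mathcal{C}_n(p)$ is the set of Catalan words of length $n$ avoiding $p$. A descent of $w$ is an index $i$ with $w_i>w_{i+1}$. $C_p(x,y)=\sum_{n,k\geq 0}c_{n,k}x^ny^k$, where $c_{n,k}$ is the number of words in $\mathcal{C}_n(p)$ with exactly $k$ descents. -}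

module Defs where

open import Data.Nat using (ℕ; zero; suc; _≤ᵇ_; _<ᵇ_; _≡ᵇ_; _∸_)
open import Data.Bool using (Bool; true; false; _∧_; _∨_; not; if_then_else_)
open import Data.List using (List; []; _∷_; map; concatMap; filter; length; upTo; zip; _++_)
open import Data.Bool.ListAction using (all; any)
open import Data.Product using (_×_; _,_)
open import Data.Integer using (ℤ; +_; _+_; _*_)
open import Relation.Nullary.Decidable using (does)
open import Relation.Binary.PropositionalEquality using (_≡_)
open import Data.Bool.Properties using () renaming (_≟_ to _≟ᵇ_)

isCatalanFrom : ℕ → List ℕ → Bool
isCatalanFrom prev [] = true
isCatalanFrom prev (x ∷ w) = (x ≤ᵇ suc prev) ∧ isCatalanFrom x w

isCatalan : List ℕ → Bool
isCatalan [] = true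
isCatalan (x ∷ w) = (x ≡ᵇ 0) ∧ isCatalanFrom x w

words : ℕ → ℕ → List (List ℕ)
words zero m = [] ∷ []
words (suc n) m = concatMap (λ x → map (x ∷_) (words n m)) (upTo m)

-- A Catalan word of length n has all letters ≤ n-1, so these are all of them.
catalanWords : ℕ → List (List ℕ)
catalanWords n = filter (λ w → isCatalan w ≟ᵇ true) (words n n)

subseqs : List ℕ → List (List ℕ)
subseqs [] = [] ∷ []
subseqs (x ∷ w) = let s = subseqs w in map (x ∷_) s ++ s

data Cmp : Set where
  LT EQ GT : Cmp

cmp : ℕ → ℕ → Cmp
cmp a b = if a <ᵇ b then LT else (if a ≡ᵇ b then EQ else GT)

sameCmp : Cmp → Cmp → Bool
sameCmp LT LT = true
sameCmp EQ EQ = true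
sameCmp GT GT = true
sameCmp _ _ = false

orderIso : List ℕ → List ℕ → Bool
orderIso u p = (length u ≡ᵇ length p) ∧
  all (λ { (a , b) → all (λ { (c , d) → sameCmp (cmp a c) (cmp b d) }) (zip u p) }) (zip u p)

contains : List ℕ → List ℕ → Bool
contains w p = any (λ s → orderIso s p) (subseqs w)

avoids : List ℕ → List ℕ → Bool
avoids w p = not (contains w p)

des : List ℕ → ℕ
des [] = 0
des (x ∷ []) = 0
des (x ∷ y ∷ w) = (if y <ᵇ x then 1 else 0) Data.Nat.+ des (y ∷ w)

c : List ℕ → ℕ → ℕ → ℕ
c p n k = length (filter (λ w → (avoids w p ∧ (des w ≡ᵇ k)) ≟ᵇ true) (catalanWords n))

-- Formal power series in x,y with integer coefficients: coefficient of x^n y^k.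
Series : Set
Series = ℕ → ℕ → ℤ

C : List ℕ → Series
C p n k = + c p n k

-- A polynomial as a list of terms (i , j , a) meaning a·x^i·y^j.
Poly : Set
Poly = List (ℕ × ℕ × ℤ)

polyCoeff : Poly → Series
polyCoeff [] n k = + 0
polyCoeff ((i , j , a) ∷ t) n k =
  (if (i ≡ᵇ n) ∧ (j ≡ᵇ k) then a else + 0) + polyCoeff t n k

polyMul : Poly → Series → Series
polyMul [] f n k = + 0
polyMul ((i , j , a) ∷ t) f n k =
  (if (i ≤ᵇ n) ∧ (j ≤ᵇ k) then a * f (n ∸ i) (k ∸ j) else + 0) + polyMul t f n k

-- 1 - 2x + x² - x²y
numer : Poly
numer = (0 , 0 , + 1) ∷ (1 , 0 , Data.Integer.-[1+ 1 ]) ∷ (2 , 0 , + 1) ∷ (2 , 1 , Data.Integer.-[1+ 0 ]) ∷ []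

-- 1 - 3x + 2x² - x²y
denom : Poly
denom = (0 , 0 , + 1) ∷ (1 , 0 , Data.Integer.-[1+ 2 ]) ∷ (2 , 0 , + 2) ∷ (2 , 1 , Data.Integer.-[1+ 0 ]) ∷ []

p120 p101 : List ℕ
p120 = 1 ∷ 2 ∷ 0 ∷ []
p101 = 1 ∷ 0 ∷ 1 ∷ []

module Submission where

-- Inside Catalan words both patterns become local conditions. A Catalan word contains 120
-- iff some letter lies at least two below an earlier one, and contains 101 iff it has a
-- valley x > y < z, i.e. it is not a weak rise followed by a weak fall. Both classes are
-- recognised by automata remembering only the running maximum and the last letter. For 120
-- the last letter is the maximum or one below it, giving counts a, b (by length and
-- descents) with a(r+1) = a(r) + b(r) and b(r+1) = 2 b(r) + y a(r); eliminating b gives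
-- a(r+2) = 3 a(r+1) - 2 a(r) + y a(r), the stated denominator. For 101 the counts depend on
-- the height v of the peak, and the identity
-- peak(v+2) + y fall(v) = peak(v+1) + y peak(v) shows that from height 0 they obey the
-- same system.

open import Defs
open import Data.Bool using (Bool; true; false; _∧_; _∨_; not; if_then_else_)
open import Data.Bool.Properties
  using (∧-zeroʳ; ∨-zeroʳ; ∨-identityʳ; ∨-assoc; ∧-distribʳ-∨; ∨-∧-booleanAlgebra) renaming (_≟_ to _≟ᵇ_)
open import Algebra.Lattice.Properties.BooleanAlgebra ∨-∧-booleanAlgebra using (deMorgan₂)
open import Data.Bool.Solver using (module ∨-∧-Solver)
open import Data.Bool.ListAction using (any)
open import Data.Empty using (⊥-elim)
import Data.Integer as ℤ
import Data.Integer.Properties as ℤ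
import Data.Integer.Solver as ℤ-Solver
open import Data.Integer using (+_; -[1+_])
open import Data.Integer.Properties using (pos-+)
open import Data.List using (List; []; _∷_; map; concat; filter; length; applyUpTo; _++_)
open import Data.List.Membership.Propositional using (_∈_)
open import Data.List.Relation.Unary.Any using (here; there)
open import Data.Nat using (ℕ; zero; suc; _+_; _∸_; _≤_; _<_; _≤ᵇ_; _<ᵇ_; _≡ᵇ_; _⊔_; z≤n; s≤s; z<s)
open import Data.Nat.Properties
open import Data.Nat.Solver using (module +-*-Solver)
open import Data.Product using (Σ-syntax; _×_; _,_)
open import Data.Sum using (_⊎_; inj₁; inj₂; [_,_]′)
open import Relation.Binary.Definitions using (tri<; tri≈; tri>)
open import Function using (_∘_)
open import Relation.Binary.PropositionalEquality
open import Relation.Nullary using (¬_)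
open import Relation.Nullary.Reflects using (Reflects; ofʸ; ofⁿ; fromEquivalence)

module _ {a} {A : Set a} where

  reflects-true⇒ : ∀ {b} → Reflects A b → b ≡ true → A
  reflects-true⇒ (ofʸ x) _ = x

  reflects⇒true : ∀ {b} → Reflects A b → A → b ≡ true
  reflects⇒true (ofʸ _) _ = refl
  reflects⇒true (ofⁿ ¬x) x = ⊥-elim (¬x x)

  reflects-false⇒ : ∀ {b} → Reflects A b → b ≡ false → ¬ A
  reflects-false⇒ (ofⁿ ¬x) _ = ¬x

  reflects⇒false : ∀ {b} → Reflects A b → ¬ A → b ≡ false
  reflects⇒false (ofʸ x) ¬x = ⊥-elim (¬x x)
  reflects⇒false (ofⁿ _) _ = refl

≡ᵇ-reflects-≡ : ∀ m n → Reflects (m ≡ n) (m ≡ᵇ n)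
≡ᵇ-reflects-≡ m n = fromEquivalence (≡ᵇ⇒≡ m n) (≡⇒≡ᵇ m n)

<ᵇ⇒<′ : ∀ m n → (m <ᵇ n) ≡ true → m < n
<ᵇ⇒<′ m n = reflects-true⇒ (<ᵇ-reflects-< m n)

¬<ᵇ⇒≥ : ∀ m n → (m <ᵇ n) ≡ false → n ≤ m
¬<ᵇ⇒≥ m n e = ≮⇒≥ (reflects-false⇒ (<ᵇ-reflects-< m n) e)

≤ᵇ⇒≤′ : ∀ m n → (m ≤ᵇ n) ≡ true → m ≤ n
≤ᵇ⇒≤′ m n = reflects-true⇒ (≤ᵇ-reflects-≤ m n)

≡ᵇ⇒≡′ : ∀ m n → (m ≡ᵇ n) ≡ true → m ≡ n
≡ᵇ⇒≡′ m n = reflects-true⇒ (≡ᵇ-reflects-≡ m n)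

module _ {m n : ℕ} where

  <⇒<ᵇ′ : m < n → (m <ᵇ n) ≡ true
  <⇒<ᵇ′ = reflects⇒true (<ᵇ-reflects-< m n)

  ≥⇒¬<ᵇ : n ≤ m → (m <ᵇ n) ≡ false
  ≥⇒¬<ᵇ n≤m = reflects⇒false (<ᵇ-reflects-< m n) (≤⇒≯ n≤m)

  ≤⇒≤ᵇ′ : m ≤ n → (m ≤ᵇ n) ≡ true
  ≤⇒≤ᵇ′ = reflects⇒true (≤ᵇ-reflects-≤ m n)

  >⇒¬≤ᵇ : n < m → (m ≤ᵇ n) ≡ false
  >⇒¬≤ᵇ n<m = reflects⇒false (≤ᵇ-reflects-≤ m n) (<⇒≱ n<m)

  ≢⇒¬≡ᵇ : m ≢ n → (m ≡ᵇ n) ≡ false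
  ≢⇒¬≡ᵇ = reflects⇒false (≡ᵇ-reflects-≡ m n)

≡ᵇ-refl : ∀ n → (n ≡ᵇ n) ≡ true
≡ᵇ-refl n = reflects⇒true (≡ᵇ-reflects-≡ n n) refl

∧-true⇒ˡ : ∀ {x y} → x ∧ y ≡ true → x ≡ true
∧-true⇒ˡ {true} _ = refl

∧-true⇒ʳ : ∀ {x y} → x ∧ y ≡ true → y ≡ true
∧-true⇒ʳ {true} e = e

∨-true⇒ : ∀ {x y} → x ∨ y ≡ true → x ≡ true ⊎ y ≡ true
∨-true⇒ {true} _ = inj₁ refl
∨-true⇒ {false} e = inj₂ e

∨-trueˡ : ∀ {x y} → x ≡ true → x ∨ y ≡ true
∨-trueˡ refl = refl

∨-trueʳ : ∀ {x y} → y ≡ true → x ∨ y ≡ true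
∨-trueʳ {x} refl = ∨-zeroʳ x

≡true-ext : ∀ {x y} → (x ≡ true → y ≡ true) → (y ≡ true → x ≡ true) → x ≡ y
≡true-ext {false} {false} _ _ = refl
≡true-ext {false} {true} _ g = g refl
≡true-ext {true} {false} f _ = sym (f refl)
≡true-ext {true} {true} _ _ = refl

-- Counting and finite sums

count : {A : Set} → (A → Bool) → List A → ℕ
count P [] = 0
count P (w ∷ L) = (if P w then 1 else 0) + count P L

module _ {A : Set} where

  length-filter≡count : (P : A → Bool) (L : List A) →
    length (filter (λ w → P w ≟ᵇ true) L) ≡ count P L
  length-filter≡count P [] = refl
  length-filter≡count P (w ∷ L) with P w
  ... | true = cong suc (length-filter≡count P L)
  ... | false = length-filter≡count P L

  count-filter : (Q P : A → Bool) (L : List A) →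
    count P (filter (λ w → Q w ≟ᵇ true) L) ≡ count (λ w → Q w ∧ P w) L
  count-filter Q P [] = refl
  count-filter Q P (w ∷ L) with Q w
  ... | true = cong (_+_ (if P w then 1 else 0)) (count-filter Q P L)
  ... | false = count-filter Q P L

  count-++ : (P : A → Bool) (L L′ : List A) → count P (L ++ L′) ≡ count P L + count P L′
  count-++ P [] L′ = refl
  count-++ P (w ∷ L) L′ = trans (cong (_+_ (if P w then 1 else 0)) (count-++ P L L′))
    (sym (+-assoc (if P w then 1 else 0) (count P L) (count P L′)))

  count-map : {B : Set} (P : A → Bool) (f : B → A) (L : List B) → count P (map f L) ≡ count (P ∘ f) L
  count-map P f [] = refl
  count-map P f (w ∷ L) = cong (_+_ (if P (f w) then 1 else 0)) (count-map P f L)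

  count-cong : {P Q : A → Bool} → (∀ w → P w ≡ Q w) → (L : List A) → count P L ≡ count Q L
  count-cong P≡Q [] = refl
  count-cong P≡Q (w ∷ L) = cong₂ (λ b n → (if b then 1 else 0) + n) (P≡Q w) (count-cong P≡Q L)

  count-false : (L : List A) → count (λ _ → false) L ≡ 0
  count-false [] = refl
  count-false (w ∷ L) = count-false L

∑ : ℕ → (ℕ → ℕ) → ℕ
∑ zero f = 0
∑ (suc m) f = ∑ m f + f m

syntax ∑ m (λ x → e) = ∑[ x < m ] e

∑-cong : ∀ m {f g : ℕ → ℕ} → (∀ x → x < m → f x ≡ g x) → ∑ m f ≡ ∑ m g
∑-cong zero f≡g = refl
∑-cong (suc m) f≡g = cong₂ _+_ (∑-cong m (λ x x<m → f≡g x (m<n⇒m<1+n x<m))) (f≡g m ≤-refl)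

∑-zero : ∀ m {f : ℕ → ℕ} → (∀ x → x < m → f x ≡ 0) → ∑ m f ≡ 0
∑-zero zero f≡0 = refl
∑-zero (suc m) f≡0 = cong₂ _+_ (∑-zero m (λ x x<m → f≡0 x (m<n⇒m<1+n x<m))) (f≡0 m ≤-refl)

∑-suc : ∀ m (f : ℕ → ℕ) → ∑ (suc m) f ≡ f 0 + ∑[ x < m ] f (suc x)
∑-suc zero f = +-comm 0 (f 0)
∑-suc (suc m) f = trans (cong (_+ f (suc m)) (∑-suc m f)) (+-assoc (f 0) _ _)

∑-truncate : ∀ {m n} (f : ℕ → ℕ) → n ≤ m → (∀ x → n ≤ x → f x ≡ 0) → ∑ m f ≡ ∑ n f
∑-truncate {m} {n} f n≤m f≡0 with m≤n⇒m<n∨m≡n n≤m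
... | inj₂ refl = refl
∑-truncate {suc m} {n} f _ f≡0 | inj₁ n<1+m =
  trans (cong₂ _+_ (∑-truncate f (m<1+n⇒m≤n n<1+m) f≡0) (f≡0 m (m<1+n⇒m≤n n<1+m))) (+-identityʳ _)

count-concat : {A : Set} (P : A → Bool) (g : ℕ → List A) (h : ℕ → ℕ) (m : ℕ) →
  count P (concat (map g (applyUpTo h m))) ≡ ∑[ x < m ] count P (g (h x))
count-concat P g h zero = refl
count-concat P g h (suc m) = trans (count-++ P (g (h 0)) _)
  (trans (cong (_+_ (count P (g (h 0)))) (count-concat P g (h ∘ suc) m))
    (sym (∑-suc m (λ x → count P (g (h x))))))

count-words-suc : (P : List ℕ → Bool) (n m : ℕ) →
  count P (words (suc n) m) ≡ ∑[ x < m ] count (λ w → P (x ∷ w)) (words n m)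
count-words-suc P n m = trans (count-concat P (λ x → map (x ∷_) (words n m)) (λ x → x) m)
  (∑-cong m (λ x _ → count-map P (x ∷_) (words n m)))

-- Subsequences and order-isomorphism

hasSubseq : ℕ → (List ℕ → Bool) → List ℕ → Bool
hasSubseq zero h w = h []
hasSubseq (suc k) h [] = false
hasSubseq (suc k) h (x ∷ w) = hasSubseq k (λ s → h (x ∷ s)) w ∨ hasSubseq (suc k) h w

module _ {A : Set} where

  any-++ : (g : A → Bool) (L L′ : List A) → any g (L ++ L′) ≡ any g L ∨ any g L′
  any-++ g [] L′ = refl
  any-++ g (s ∷ L) L′ = trans (cong (g s ∨_) (any-++ g L L′)) (sym (∨-assoc (g s) _ _))

  any-map : {B : Set} (g : A → Bool) (f : B → A) (L : List B) → any g (map f L) ≡ any (g ∘ f) L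
  any-map g f [] = refl
  any-map g f (s ∷ L) = cong (g (f s) ∨_) (any-map g f L)

  any-cong : {g g′ : A → Bool} → (∀ s → g s ≡ g′ s) → (L : List A) → any g L ≡ any g′ L
  any-cong g≡g′ [] = refl
  any-cong g≡g′ (s ∷ L) = cong₂ _∨_ (g≡g′ s) (any-cong g≡g′ L)

  any-false : (L : List A) → any (λ _ → false) L ≡ false
  any-false [] = refl
  any-false (s ∷ L) = any-false L

any-subseqs≡hasSubseq : (w : List ℕ) (k : ℕ) (h : List ℕ → Bool) →
  any (λ s → (length s ≡ᵇ k) ∧ h s) (subseqs w) ≡ hasSubseq k h w
any-subseqs≡hasSubseq [] zero h = ∨-identityʳ (h [])
any-subseqs≡hasSubseq [] (suc k) h = refl
any-subseqs≡hasSubseq (x ∷ w) k h =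
  trans (any-++ _ (map (x ∷_) (subseqs w)) (subseqs w))
    (trans (cong (_∨ any (λ s → (length s ≡ᵇ k) ∧ h s) (subseqs w)) (any-map _ (x ∷_) (subseqs w)))
      (split k h))
  where
  split : (k : ℕ) (h : List ℕ → Bool) →
    any (λ s → (suc (length s) ≡ᵇ k) ∧ h (x ∷ s)) (subseqs w) ∨ any (λ s → (length s ≡ᵇ k) ∧ h s) (subseqs w)
      ≡ hasSubseq k h (x ∷ w)
  split zero h = trans (cong (_∨ any (λ s → (length s ≡ᵇ 0) ∧ h s) (subseqs w)) (any-false (subseqs w)))
    (any-subseqs≡hasSubseq w zero h)
  split (suc k) h = cong₂ _∨_ (any-subseqs≡hasSubseq w k (λ s → h (x ∷ s))) (any-subseqs≡hasSubseq w (suc k) h)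

contains≡hasSubseq : (w p : List ℕ) → contains w p ≡ hasSubseq (length p) (λ s → orderIso s p) w
contains≡hasSubseq w p = trans (any-cong sameLength (subseqs w)) (any-subseqs≡hasSubseq w (length p) _)
  where
  sameLength : ∀ s → orderIso s p ≡ (length s ≡ᵇ length p) ∧ orderIso s p
  sameLength s with length s ≡ᵇ length p
  ... | true = refl
  ... | false = refl

hasSubseq₁-intro : (h : List ℕ → Bool) {z : ℕ} {s : List ℕ} → z ∈ s → h (z ∷ []) ≡ true → hasSubseq 1 h s ≡ true
hasSubseq₁-intro h (here refl) e = ∨-trueˡ e
hasSubseq₁-intro h (there z∈s) e = ∨-trueʳ (hasSubseq₁-intro h z∈s e)

hasSubseq₁-elim : (h : List ℕ → Bool) (s : List ℕ) → hasSubseq 1 h s ≡ true → Σ[ z ∈ ℕ ] (z ∈ s × h (z ∷ []) ≡ true)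
hasSubseq₁-elim h (y ∷ s) e with ∨-true⇒ e
... | inj₁ hy = y , here refl , hy
... | inj₂ e′ with hasSubseq₁-elim h s e′
... | z , z∈s , hz = z , there z∈s , hz

hasSubseq-false : ∀ k {h : List ℕ → Bool} → (∀ t → h t ≡ false) → ∀ s → hasSubseq k h s ≡ false
hasSubseq-false zero h≡false s = h≡false []
hasSubseq-false (suc k) h≡false [] = refl
hasSubseq-false (suc k) h≡false (x ∷ s) =
  cong₂ _∨_ (hasSubseq-false k (λ t → h≡false (x ∷ t)) s) (hasSubseq-false (suc k) h≡false s)

hasSubseq-∨ : ∀ k {h f g : List ℕ → Bool} → (∀ t → h t ≡ f t ∨ g t) → ∀ s →
  hasSubseq k h s ≡ hasSubseq k f s ∨ hasSubseq k g s
hasSubseq-∨ zero h≡f∨g s = h≡f∨g []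
hasSubseq-∨ (suc k) h≡f∨g [] = refl
hasSubseq-∨ (suc k) {h} {f} {g} h≡f∨g (x ∷ s) =
  trans (cong₂ _∨_ (hasSubseq-∨ k (λ t → h≡f∨g (x ∷ t)) s) (hasSubseq-∨ (suc k) h≡f∨g s))
    (interchange (hasSubseq k (λ t → f (x ∷ t)) s) (hasSubseq k (λ t → g (x ∷ t)) s)
                 (hasSubseq (suc k) f s) (hasSubseq (suc k) g s))
  where
  open ∨-∧-Solver
  interchange : ∀ a b c d → (a ∨ b) ∨ (c ∨ d) ≡ (a ∨ c) ∨ (b ∨ d)
  interchange = solve 4 (λ a b c d → (a :+ b) :+ (c :+ d) := (a :+ c) :+ (b :+ d)) refl

sameCmp⇒≡ : ∀ {c d} → sameCmp c d ≡ true → c ≡ d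
sameCmp⇒≡ {LT} {LT} _ = refl
sameCmp⇒≡ {EQ} {EQ} _ = refl
sameCmp⇒≡ {GT} {GT} _ = refl

module _ {a b : ℕ} where

  <⇒cmp≡LT : a < b → cmp a b ≡ LT
  <⇒cmp≡LT a<b rewrite <⇒<ᵇ′ a<b = refl

  >⇒cmp≡GT : b < a → cmp a b ≡ GT
  >⇒cmp≡GT b<a rewrite ≥⇒¬<ᵇ (<⇒≤ b<a) | ≢⇒¬≡ᵇ (>⇒≢ b<a) = refl

  cmp≡LT⇒< : cmp a b ≡ LT → a < b
  cmp≡LT⇒< e with a <ᵇ b in a<ᵇb | a ≡ᵇ b
  ... | true | _ = <ᵇ⇒<′ a b a<ᵇb
  cmp≡LT⇒< () | false | true
  cmp≡LT⇒< () | false | false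

  cmp≡EQ⇒≡ : cmp a b ≡ EQ → a ≡ b
  cmp≡EQ⇒≡ e with a <ᵇ b | a ≡ᵇ b in a≡ᵇb
  ... | false | true = ≡ᵇ⇒≡′ a b a≡ᵇb
  cmp≡EQ⇒≡ () | true | _
  cmp≡EQ⇒≡ () | false | false

  cmp≡GT⇒> : cmp a b ≡ GT → b < a
  cmp≡GT⇒> e with a <ᵇ b in a<ᵇb | a ≡ᵇ b in a≡ᵇb
  ... | false | false = ≤∧≢⇒< (¬<ᵇ⇒≥ a b a<ᵇb) (λ b≡a → reflects-false⇒ (≡ᵇ-reflects-≡ a b) a≡ᵇb (sym b≡a))
  cmp≡GT⇒> () | true | _
  cmp≡GT⇒> () | false | true

cmp-refl : ∀ a → cmp a a ≡ EQ
cmp-refl a rewrite ≥⇒¬<ᵇ (≤-refl {a}) | ≡ᵇ-refl a = refl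

orderIso-120 : ∀ x y z → z < x → x < y → orderIso (x ∷ y ∷ z ∷ []) p120 ≡ true
orderIso-120 x y z z<x x<y
  rewrite cmp-refl x | cmp-refl y | cmp-refl z | <⇒cmp≡LT x<y | >⇒cmp≡GT z<x | >⇒cmp≡GT x<y
        | >⇒cmp≡GT (<-trans z<x x<y) | <⇒cmp≡LT z<x | <⇒cmp≡LT (<-trans z<x x<y) = refl

orderIso-101 : ∀ x y → y < x → orderIso (x ∷ y ∷ x ∷ []) p101 ≡ true
orderIso-101 x y y<x rewrite cmp-refl x | cmp-refl y | >⇒cmp≡GT y<x | <⇒cmp≡LT y<x = refl

orderIso-120⁻¹ : ∀ {x y z} → orderIso (x ∷ y ∷ z ∷ []) p120 ≡ true → z < x × x < y
orderIso-120⁻¹ {x} {y} {z} e = cmp≡GT⇒> (sameCmp⇒≡ x-vs-z) , cmp≡LT⇒< (sameCmp⇒≡ x-vs-y)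
  where
  x-row : sameCmp (cmp x x) EQ ∧ (sameCmp (cmp x y) LT ∧ (sameCmp (cmp x z) GT ∧ true)) ≡ true
  x-row = ∧-true⇒ˡ (∧-true⇒ʳ {true} e)
  x-vs-y : sameCmp (cmp x y) LT ≡ true
  x-vs-y = ∧-true⇒ˡ (∧-true⇒ʳ {sameCmp (cmp x x) EQ} x-row)
  x-vs-z : sameCmp (cmp x z) GT ≡ true
  x-vs-z = ∧-true⇒ˡ (∧-true⇒ʳ {sameCmp (cmp x y) LT} (∧-true⇒ʳ {sameCmp (cmp x x) EQ} x-row))

orderIso-101⁻¹ : ∀ {x y z} → orderIso (x ∷ y ∷ z ∷ []) p101 ≡ true → y < x × x ≡ z
orderIso-101⁻¹ {x} {y} {z} e = cmp≡GT⇒> (sameCmp⇒≡ x-vs-y) , cmp≡EQ⇒≡ (sameCmp⇒≡ x-vs-z)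
  where
  x-row : sameCmp (cmp x x) EQ ∧ (sameCmp (cmp x y) GT ∧ (sameCmp (cmp x z) EQ ∧ true)) ≡ true
  x-row = ∧-true⇒ˡ (∧-true⇒ʳ {true} e)
  x-vs-y : sameCmp (cmp x y) GT ≡ true
  x-vs-y = ∧-true⇒ˡ (∧-true⇒ʳ {sameCmp (cmp x x) EQ} x-row)
  x-vs-z : sameCmp (cmp x z) EQ ≡ true
  x-vs-z = ∧-true⇒ˡ (∧-true⇒ʳ {sameCmp (cmp x y) GT} (∧-true⇒ʳ {sameCmp (cmp x x) EQ} x-row))

-- Pattern containment in Catalan words

isCatalanFrom-head : ∀ v x s → isCatalanFrom v (x ∷ s) ≡ true → x ≤ suc v
isCatalanFrom-head v x s c = ≤ᵇ⇒≤′ x (suc v) (∧-true⇒ˡ c)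

isCatalanFrom-tail : ∀ v x s → isCatalanFrom v (x ∷ s) ≡ true → isCatalanFrom x s ≡ true
isCatalanFrom-tail v x s c = ∧-true⇒ʳ {x ≤ᵇ suc v} c

-- A Catalan word rises by steps of one, so it cannot skip a value on its way up.
isCatalanFrom-passes : ∀ {x z} u t → isCatalanFrom u t ≡ true → u < x → z ∈ t → x < z → x ∈ t
isCatalanFrom-passes u (y ∷ t) c u<x (here refl) x<z =
  ⊥-elim (<⇒≱ x<z (≤-trans (isCatalanFrom-head u y t c) u<x))
isCatalanFrom-passes {x} u (y ∷ t) c u<x (there z∈t) x<z
  with m≤n⇒m<n∨m≡n {y} {x} (≤-trans (isCatalanFrom-head u y t c) u<x)
... | inj₂ refl = here refl
... | inj₁ y<x = there (isCatalanFrom-passes y t (isCatalanFrom-tail u y t c) y<x z∈t x<z)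

hasOccurrence : List ℕ → List ℕ → Bool
hasOccurrence p = hasSubseq 3 (λ t → orderIso t p)

hasOccurrenceAfter : List ℕ → ℕ → List ℕ → Bool
hasOccurrenceAfter p b = hasSubseq 2 (λ t → orderIso (b ∷ t) p)

twoBelow : ℕ → List ℕ → Bool
twoBelow M [] = false
twoBelow M (z ∷ _) = 2 + z ≤ᵇ M

startsBigDrop : List ℕ → Bool
startsBigDrop [] = false
startsBigDrop (y ∷ t) = twoBelow y t

hasBigDrop : List ℕ → Bool
hasBigDrop = hasSubseq 2 startsBigDrop

occurrenceAfter120⇒bigDrop : ∀ x s → hasOccurrenceAfter p120 x s ≡ true → hasBigDrop s ≡ true
occurrenceAfter120⇒bigDrop x (y ∷ t) h with ∨-true⇒ h
... | inj₂ h′ = ∨-trueʳ (occurrenceAfter120⇒bigDrop x t h′)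
... | inj₁ h′ with hasSubseq₁-elim _ t h′
... | z , z∈t , xyz≅120 with orderIso-120⁻¹ {x} {y} {z} xyz≅120
... | z<x , x<y = ∨-trueˡ (hasSubseq₁-intro (twoBelow y) z∈t (≤⇒≤ᵇ′ (≤-trans (s≤s z<x) x<y)))

occurrence120⇒bigDrop : ∀ s → hasOccurrence p120 s ≡ true → hasBigDrop s ≡ true
occurrence120⇒bigDrop (x ∷ s) h with ∨-true⇒ h
... | inj₁ h′ = ∨-trueʳ (occurrenceAfter120⇒bigDrop x s h′)
... | inj₂ h′ = ∨-trueʳ (occurrence120⇒bigDrop s h′)

-- In a Catalan word every value b ≤ v occurs before v, so an occurrence lacking only a first
-- letter b ≤ v can always be completed; from v = 0 the missing letter is the initial 0.
bigDrop⇒occurrence120 : ∀ v s → isCatalanFrom v s ≡ true → hasBigDrop s ≡ true →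
  hasOccurrence p120 s ≡ true ⊎ Σ[ b ∈ ℕ ] (b ≤ v × hasOccurrenceAfter p120 b s ≡ true)
bigDrop⇒occurrence120 v (x ∷ s) c d with ∨-true⇒ d
... | inj₁ d′ with hasSubseq₁-elim _ s d′
...   | z , z∈s , 2+z≤x = inj₂ (suc z , ≤-pred (≤-trans (≤ᵇ⇒≤′ (2 + z) x 2+z≤x) (isCatalanFrom-head v x s c)) ,
          ∨-trueˡ (hasSubseq₁-intro _ z∈s (orderIso-120 (suc z) x z ≤-refl (≤ᵇ⇒≤′ (2 + z) x 2+z≤x))))
bigDrop⇒occurrence120 v (x ∷ s) c d | inj₂ d′ with bigDrop⇒occurrence120 x s (isCatalanFrom-tail v x s c) d′
... | inj₁ h = inj₁ (∨-trueʳ h)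
... | inj₂ (b , b≤x , h) with m≤n⇒m<n∨m≡n b≤x
...   | inj₂ refl = inj₁ (∨-trueˡ h)
...   | inj₁ b<x = inj₂ (b , ≤-pred (≤-trans b<x (isCatalanFrom-head v x s c)) , ∨-trueʳ h)

contains-120 : ∀ s → isCatalanFrom 0 s ≡ true → contains (0 ∷ s) p120 ≡ hasBigDrop (0 ∷ s)
contains-120 s c = trans (contains≡hasSubseq (0 ∷ s) p120) (≡true-ext (occurrence120⇒bigDrop (0 ∷ s)) ⇐)
  where
  ⇐ : hasBigDrop (0 ∷ s) ≡ true → hasOccurrence p120 (0 ∷ s) ≡ true
  ⇐ d with ∨-true⇒ d
  ... | inj₁ d′ with hasSubseq₁-elim _ s d′
  ...   | _ , _ , ()
  ⇐ d | inj₂ d′ with bigDrop⇒occurrence120 0 s c d′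
  ... | inj₁ h = ∨-trueʳ h
  ... | inj₂ (.zero , z≤n , h) = ∨-trueˡ h

isValley : List ℕ → Bool
isValley (x ∷ y ∷ z ∷ _) = (y <ᵇ x) ∧ (y <ᵇ z)
isValley _ = false

hasValleyFrom : ℕ → List ℕ → Bool
hasValleyFrom x = hasSubseq 2 (λ t → isValley (x ∷ t))

hasValley : List ℕ → Bool
hasValley = hasSubseq 3 isValley

occurrenceAfter101⇒valleyFrom : ∀ x s → hasOccurrenceAfter p101 x s ≡ true → hasValleyFrom x s ≡ true
occurrenceAfter101⇒valleyFrom x (y ∷ t) h with ∨-true⇒ h
... | inj₂ h′ = ∨-trueʳ (occurrenceAfter101⇒valleyFrom x t h′)
... | inj₁ h′ with hasSubseq₁-elim _ t h′
... | z , z∈t , xyz≅101 with orderIso-101⁻¹ {x} {y} {z} xyz≅101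
... | y<x , refl = ∨-trueˡ (hasSubseq₁-intro _ z∈t (cong₂ _∧_ (<⇒<ᵇ′ y<x) (<⇒<ᵇ′ y<x)))

occurrence101⇒valley : ∀ s → hasOccurrence p101 s ≡ true → hasValley s ≡ true
occurrence101⇒valley (x ∷ s) h with ∨-true⇒ h
... | inj₁ h′ = ∨-trueˡ (occurrenceAfter101⇒valleyFrom x s h′)
... | inj₂ h′ = ∨-trueʳ (occurrence101⇒valley s h′)

-- A valley x > y < z yields the occurrence z y z if z < x and x y x otherwise: if z > x, the
-- word climbs through x again between y and z.
valleyFrom⇒occurrence101 : ∀ u x s → isCatalanFrom u s ≡ true → hasValleyFrom x s ≡ true →
  hasOccurrenceAfter p101 x s ≡ true ⊎ Σ[ b ∈ ℕ ] (b < x × hasOccurrenceAfter p101 b s ≡ true)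
valleyFrom⇒occurrence101 u x (y ∷ t) c v with ∨-true⇒ v
... | inj₂ v′ with valleyFrom⇒occurrence101 y x t (isCatalanFrom-tail u y t c) v′
...   | inj₁ h = inj₁ (∨-trueʳ h)
...   | inj₂ (b , b<x , h) = inj₂ (b , b<x , ∨-trueʳ h)
valleyFrom⇒occurrence101 u x (y ∷ t) c v | inj₁ v′ with hasSubseq₁-elim _ t v′
... | z , z∈t , e with <ᵇ⇒<′ y x (∧-true⇒ˡ e) | <ᵇ⇒<′ y z (∧-true⇒ʳ {y <ᵇ x} e) | <-cmp z x
... | y<x | y<z | tri< z<x _ _ = inj₂ (z , z<x , ∨-trueˡ (hasSubseq₁-intro _ z∈t (orderIso-101 z y y<z)))
... | y<x | y<z | tri≈ _ refl _ = inj₁ (∨-trueˡ (hasSubseq₁-intro _ z∈t (orderIso-101 x y y<x)))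
... | y<x | y<z | tri> _ _ x<z = inj₁ (∨-trueˡ (hasSubseq₁-intro _
        (isCatalanFrom-passes y t (isCatalanFrom-tail u y t c) y<x z∈t x<z) (orderIso-101 x y y<x)))

valley⇒occurrence101 : ∀ v s → isCatalanFrom v s ≡ true → hasValley s ≡ true →
  hasOccurrence p101 s ≡ true ⊎ Σ[ b ∈ ℕ ] (b ≤ v × hasOccurrenceAfter p101 b s ≡ true)
valley⇒occurrence101 v (x ∷ s) c h with ∨-true⇒ h
... | inj₁ h′ with valleyFrom⇒occurrence101 x x s (isCatalanFrom-tail v x s c) h′
...   | inj₁ o = inj₁ (∨-trueˡ o)
...   | inj₂ (b , b<x , o) = inj₂ (b , ≤-pred (≤-trans b<x (isCatalanFrom-head v x s c)) , ∨-trueʳ o)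
valley⇒occurrence101 v (x ∷ s) c h | inj₂ h′ with valley⇒occurrence101 x s (isCatalanFrom-tail v x s c) h′
... | inj₁ o = inj₁ (∨-trueʳ o)
... | inj₂ (b , b≤x , o) with m≤n⇒m<n∨m≡n b≤x
...   | inj₂ refl = inj₁ (∨-trueˡ o)
...   | inj₁ b<x = inj₂ (b , ≤-pred (≤-trans b<x (isCatalanFrom-head v x s c)) , ∨-trueʳ o)

hasValleyFrom-0 : ∀ s → hasValleyFrom 0 s ≡ false
hasValleyFrom-0 = hasSubseq-false 2 noValley
  where
  noValley : ∀ t → isValley (0 ∷ t) ≡ false
  noValley [] = refl
  noValley (_ ∷ []) = refl
  noValley (_ ∷ _ ∷ _) = refl

contains-101 : ∀ s → isCatalanFrom 0 s ≡ true → contains (0 ∷ s) p101 ≡ hasValley (0 ∷ s)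
contains-101 s c = trans (contains≡hasSubseq (0 ∷ s) p101) (≡true-ext (occurrence101⇒valley (0 ∷ s)) ⇐)
  where
  ⇐ : hasValley (0 ∷ s) ≡ true → hasOccurrence p101 (0 ∷ s) ≡ true
  ⇐ h rewrite hasValleyFrom-0 s with valley⇒occurrence101 0 s c h
  ... | inj₁ o = ∨-trueʳ o
  ... | inj₂ (.zero , z≤n , o) = ∨-trueˡ o

-- Automata recognising the avoiders

-- The automaton reads a word letter by letter, keeping the running maximum M and the
-- previous letter v; ok M v x says whether x may come next.
accepts : (ℕ → ℕ → ℕ → Bool) → ℕ → ℕ → List ℕ → Bool
accepts ok M v [] = true
accepts ok M v (x ∷ s) = ok M v x ∧ accepts ok (M ⊔ x) x s

step120 : ℕ → ℕ → ℕ → Bool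
step120 M v x = (x ≤ᵇ suc v) ∧ not (twoBelow M (x ∷ []))

step101 : ℕ → ℕ → ℕ → Bool
step101 M v x = (x ≤ᵇ suc v) ∧ not (isValley (M ∷ v ∷ x ∷ []))

≤ᵇ-⊔ : ∀ a M x → (a ≤ᵇ M ⊔ x) ≡ (a ≤ᵇ M) ∨ (a ≤ᵇ x)
≤ᵇ-⊔ a M x with ≤-total M x
... | inj₁ M≤x rewrite m≤n⇒m⊔n≡n M≤x = ≡true-ext ∨-trueʳ
      (λ h → [ (λ a≤M → ≤⇒≤ᵇ′ (≤-trans (≤ᵇ⇒≤′ a M a≤M) M≤x)) , (λ a≤x → a≤x) ]′ (∨-true⇒ h))
... | inj₂ x≤M rewrite m≥n⇒m⊔n≡m x≤M = ≡true-ext ∨-trueˡ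
      (λ h → [ (λ a≤M → a≤M) , (λ a≤x → ≤⇒≤ᵇ′ (≤-trans (≤ᵇ⇒≤′ a x a≤x) x≤M)) ]′ (∨-true⇒ h))

twoBelow-⊔ : ∀ M x t → twoBelow (M ⊔ x) t ≡ twoBelow M t ∨ twoBelow x t
twoBelow-⊔ M x [] = refl
twoBelow-⊔ M x (z ∷ _) = ≤ᵇ-⊔ (2 + z) M x

accepts-step120 : ∀ M v s →
  accepts step120 M v s ≡ isCatalanFrom v s ∧ (not (hasSubseq 1 (twoBelow M) s) ∧ not (hasBigDrop s))
accepts-step120 M v [] = refl
accepts-step120 M v (x ∷ s) =
  begin
    ((x ≤ᵇ suc v) ∧ not (2 + x ≤ᵇ M)) ∧ accepts step120 (M ⊔ x) x s
  ≡⟨ cong (((x ≤ᵇ suc v) ∧ not (2 + x ≤ᵇ M)) ∧_) (accepts-step120 (M ⊔ x) x s) ⟩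
    ((x ≤ᵇ suc v) ∧ not (2 + x ≤ᵇ M)) ∧ (isCatalanFrom x s ∧ (not (hasSubseq 1 (twoBelow (M ⊔ x)) s) ∧ not (hasBigDrop s)))
  ≡⟨ cong (λ L → ((x ≤ᵇ suc v) ∧ not (2 + x ≤ᵇ M)) ∧ (isCatalanFrom x s ∧ (not L ∧ not (hasBigDrop s))))
          (hasSubseq-∨ 1 (twoBelow-⊔ M x) s) ⟩
    ((x ≤ᵇ suc v) ∧ not (2 + x ≤ᵇ M)) ∧
      (isCatalanFrom x s ∧ (not (hasSubseq 1 (twoBelow M) s ∨ hasSubseq 1 (twoBelow x) s) ∧ not (hasBigDrop s)))
  ≡⟨ regroup (x ≤ᵇ suc v) (2 + x ≤ᵇ M) (isCatalanFrom x s) (hasSubseq 1 (twoBelow M) s)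
             (hasSubseq 1 (twoBelow x) s) (hasBigDrop s) ⟩
    isCatalanFrom v (x ∷ s) ∧ (not (hasSubseq 1 (twoBelow M) (x ∷ s)) ∧ not (hasBigDrop (x ∷ s)))
  ∎
  where
  open ≡-Reasoning
  regroup : ∀ a b c l y d → (a ∧ not b) ∧ (c ∧ (not (l ∨ y) ∧ not d)) ≡ (a ∧ c) ∧ (not (b ∨ l) ∧ not (y ∨ d))
  regroup a b c l y d rewrite deMorgan₂ l y | deMorgan₂ b l | deMorgan₂ y d =
    solve 6 (λ a b c l y d → (a :* b) :* (c :* ((l :* y) :* d)) := (a :* c) :* ((b :* l) :* (y :* d))) refl
      a (not b) c (not l) (not y) (not d)
    where open ∨-∧-Solver

isValley-⊔ : ∀ M x t → isValley (M ⊔ x ∷ t) ≡ isValley (M ∷ t) ∨ isValley (x ∷ t)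
isValley-⊔ M x [] = refl
isValley-⊔ M x (_ ∷ []) = refl
isValley-⊔ M x (y ∷ z ∷ _) rewrite ≤ᵇ-⊔ (suc y) M x = ∧-distribʳ-∨ (y <ᵇ z) (y <ᵇ M) (y <ᵇ x)

hasValleyFrom-⊔ : ∀ M x s → hasValleyFrom (M ⊔ x) (x ∷ s) ≡ hasValleyFrom M (x ∷ s) ∨ hasValleyFrom x s
hasValleyFrom-⊔ M x s =
  trans (hasSubseq-∨ 2 (isValley-⊔ M x) (x ∷ s))
    (cong (hasValleyFrom M (x ∷ s) ∨_) (cong (_∨ hasValleyFrom x s) (hasSubseq-false 1 noValley s)))
  where
  noValley : ∀ t → isValley (x ∷ x ∷ t) ≡ false
  noValley [] = refl
  noValley (_ ∷ _) rewrite ≥⇒¬<ᵇ (≤-refl {x}) = refl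

-- Unless M v x is itself a valley, x ≤ v and the valley M v z gives the valley M x z.
valley-moves-right : ∀ M v x s →
  hasSubseq 1 (λ u → isValley (M ∷ v ∷ u)) s ≡ true →
  isValley (M ∷ v ∷ x ∷ []) ∨ hasValleyFrom M (x ∷ s) ≡ true
valley-moves-right M v x s w with hasSubseq₁-elim _ s w
... | z , z∈s , Mvz with v <ᵇ x in v<ᵇx
...   | true = ∨-trueˡ (cong (_∧ true) (∧-true⇒ˡ {v <ᵇ M} Mvz))
...   | false = ∨-trueʳ {(v <ᵇ M) ∧ false} (∨-trueˡ (hasSubseq₁-intro (λ u → isValley (M ∷ x ∷ u)) z∈s
          (cong₂ _∧_ (<⇒<ᵇ′ (≤-<-trans x≤v (<ᵇ⇒<′ v M (∧-true⇒ˡ {v <ᵇ M} Mvz))))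
                     (<⇒<ᵇ′ (≤-<-trans x≤v (<ᵇ⇒<′ v z (∧-true⇒ʳ {v <ᵇ M} Mvz)))))))
  where
  x≤v : x ≤ v
  x≤v = ¬<ᵇ⇒≥ v x v<ᵇx

accepts-step101 : ∀ M v s →
  accepts step101 M v s ≡ isCatalanFrom v s ∧ (not (hasValleyFrom M (v ∷ s)) ∧ not (hasValley s))
accepts-step101 M v [] = refl
accepts-step101 M v (x ∷ s) =
  begin
    ((x ≤ᵇ suc v) ∧ not vx) ∧ accepts step101 (M ⊔ x) x s
  ≡⟨ cong (((x ≤ᵇ suc v) ∧ not vx) ∧_) (accepts-step101 (M ⊔ x) x s) ⟩
    ((x ≤ᵇ suc v) ∧ not vx) ∧ (isCatalanFrom x s ∧ (not (hasValleyFrom (M ⊔ x) (x ∷ s)) ∧ not (hasValley s)))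
  ≡⟨ cong (λ q → ((x ≤ᵇ suc v) ∧ not vx) ∧ (isCatalanFrom x s ∧ (not q ∧ not (hasValley s))))
          (hasValleyFrom-⊔ M x s) ⟩
    ((x ≤ᵇ suc v) ∧ not vx) ∧
      (isCatalanFrom x s ∧ (not (hasValleyFrom M (x ∷ s) ∨ hasValleyFrom x s) ∧ not (hasValley s)))
  ≡⟨ regroup (x ≤ᵇ suc v) (isCatalanFrom x s) vx (hasSubseq 1 (λ u → isValley (M ∷ v ∷ u)) s)
             (hasValleyFrom M (x ∷ s)) (hasValleyFrom x s) (hasValley s) (valley-moves-right M v x s) ⟩
    isCatalanFrom v (x ∷ s) ∧ (not (hasValleyFrom M (v ∷ x ∷ s)) ∧ not (hasValley (x ∷ s)))
  ∎
  where
  open ≡-Reasoning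
  vx : Bool
  vx = isValley (M ∷ v ∷ x ∷ [])
  regroup : ∀ a c vx w q y e → (w ≡ true → vx ∨ q ≡ true) →
    (a ∧ not vx) ∧ (c ∧ (not (q ∨ y) ∧ not e)) ≡ (a ∧ c) ∧ (not ((vx ∨ w) ∨ q) ∧ not (y ∨ e))
  regroup false c vx w q y e _ = refl
  regroup true false true w q y e _ = refl
  regroup true false false w q y e _ = refl
  regroup true true true w q y e _ = refl
  regroup true true false false true y e _ = refl
  regroup true true false false false true e _ = refl
  regroup true true false false false false e _ = refl
  regroup true true false true q y e w⇒q rewrite w⇒q refl = refl

-- Counting accepted words by descents

δ₀ : ℕ → ℕ
δ₀ zero = 1
δ₀ (suc _) = 0

-- shiftY f is the coefficient sequence of y · ∑ f d yᵈ.
shiftY : (ℕ → ℕ) → ℕ → ℕ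
shiftY f zero = 0
shiftY f (suc d) = f d

shiftY-cong : ∀ {f g : ℕ → ℕ} → (∀ d → f d ≡ g d) → ∀ d → shiftY f d ≡ shiftY g d
shiftY-cong f≡g zero = refl
shiftY-cong f≡g (suc d) = f≡g d

∑-shiftY : ∀ n (g : ℕ → ℕ → ℕ) d → ∑[ x < n ] shiftY (g x) d ≡ shiftY (λ e → ∑[ x < n ] g x e) d
∑-shiftY n g zero = ∑-zero n (λ _ _ → refl)
∑-shiftY n g (suc d) = refl

branch : Bool → Bool → (ℕ → ℕ) → ℕ → ℕ
branch allowed descent f d = if allowed then (if descent then shiftY f d else f d) else 0

count-branch : {X : Set} (b c : Bool) (A : X → Bool) (D : X → ℕ) (L : List X) (d : ℕ) →
  count (λ s → (b ∧ A s) ∧ (((if c then 1 else 0) + D s) ≡ᵇ d)) L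
    ≡ branch b c (λ d′ → count (λ s → A s ∧ (D s ≡ᵇ d′)) L) d
count-branch false c A D L d = count-false L
count-branch true false A D L d = refl
count-branch true true A D L zero = trans (count-cong (λ s → ∧-zeroʳ (A s)) L) (count-false L)
count-branch true true A D L (suc d) = refl

acceptedCount : (ℕ → ℕ → ℕ → Bool) → ℕ → ℕ → ℕ → ℕ → ℕ → ℕ
acceptedCount ok m r M v d = count (λ s → accepts ok M v s ∧ (des (v ∷ s) ≡ᵇ d)) (words r m)

acceptedCount-zero : ∀ ok m M v d → acceptedCount ok m 0 M v d ≡ δ₀ d
acceptedCount-zero ok m M v zero = refl
acceptedCount-zero ok m M v (suc d) = refl

module FirstLetter (ok : ℕ → ℕ → ℕ → Bool) (m r M v d : ℕ) where

  startingWith : ℕ → ℕ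
  startingWith x = branch (ok M v x) (x <ᵇ v) (acceptedCount ok m r (M ⊔ x) x) d

  acceptedCount-suc : acceptedCount ok m (suc r) M v d ≡ ∑[ x < m ] startingWith x
  acceptedCount-suc = trans (count-words-suc _ r m) (∑-cong m (λ x _ →
    count-branch (ok M v x) (x <ᵇ v) (accepts ok (M ⊔ x) x) (λ s → des (x ∷ s)) (words r m) d))

  startingWith-reject : ∀ x → ok M v x ≡ false → startingWith x ≡ 0
  startingWith-reject x e rewrite e = refl

  startingWith-noDescent : ∀ {M′} x → ok M v x ≡ true → v ≤ x → M ⊔ x ≡ M′ →
    startingWith x ≡ acceptedCount ok m r M′ x d
  startingWith-noDescent x e v≤x refl rewrite e | ≥⇒¬<ᵇ v≤x = refl

  startingWith-descent : ∀ {M′} x → ok M v x ≡ true → x < v → M ⊔ x ≡ M′ →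
    startingWith x ≡ shiftY (acceptedCount ok m r M′ x) d
  startingWith-descent x e x<v refl rewrite e | <⇒<ᵇ′ x<v = refl

module _ {v r m : ℕ} (bound : v + suc r < m) where

  next<bound : suc v < m
  next<bound = ≤-<-trans (m<m+n v z<s) bound

  tail<bound : ∀ {x} → x ≤ v → x + r < m
  tail<bound x≤v = ≤-<-trans (+-mono-≤ x≤v (n≤1+n r)) bound

  tail<bound-suc : suc v + r < m
  tail<bound-suc = ≤-<-trans (≤-reflexive (sym (+-suc v r))) bound

step120-accept : ∀ M v x → x ≤ suc v → M ≤ suc x → step120 M v x ≡ true
step120-accept M v x x≤1+v M≤1+x rewrite ≤⇒≤ᵇ′ x≤1+v | >⇒¬≤ᵇ {2 + x} {M} (s≤s M≤1+x) = refl

step120-reject-high : ∀ M v x → suc v < x → step120 M v x ≡ false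
step120-reject-high M v x 1+v<x rewrite >⇒¬≤ᵇ 1+v<x = refl

step120-reject-low : ∀ M v x → suc x < M → step120 M v x ≡ false
step120-reject-low M v x 1+x<M rewrite ≤⇒≤ᵇ′ 1+x<M = ∧-zeroʳ (x ≤ᵇ suc v)

a b : ℕ → ℕ → ℕ
a zero d = δ₀ d
a (suc r) d = a r d + b r d
b zero d = δ₀ d
b (suc r) d = (b r d + b r d) + shiftY (a r) d

module _ (m : ℕ) where

  count120-below : ∀ r v d → v + r < m → acceptedCount step120 m r (suc v) v d ≡ a r d
  count120-top : ∀ r v d → suc v + r < m → acceptedCount step120 m r (suc v) (suc v) d ≡ b r d

  count120-below zero v d _ = acceptedCount-zero step120 m (suc v) v d
  count120-below (suc r) v d bound =
    begin
      acceptedCount step120 m (suc r) (suc v) v d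
    ≡⟨ acceptedCount-suc ⟩
      ∑[ x < m ] startingWith x
    ≡⟨ ∑-truncate startingWith (next<bound bound)
         (λ x 2+v≤x → startingWith-reject x (step120-reject-high (suc v) v x 2+v≤x)) ⟩
      ∑[ x < v ] startingWith x + startingWith v + startingWith (suc v)
    ≡⟨ cong (λ n → n + startingWith v + startingWith (suc v))
         (∑-zero v (λ x x<v → startingWith-reject x (step120-reject-low (suc v) v x (s≤s x<v)))) ⟩
      startingWith v + startingWith (suc v)
    ≡⟨ cong₂ _+_
         (startingWith-noDescent v (step120-accept (suc v) v v (n≤1+n v) ≤-refl) ≤-refl (m≥n⇒m⊔n≡m (n≤1+n v)))
         (startingWith-noDescent (suc v) (step120-accept (suc v) v (suc v) ≤-refl (n≤1+n (suc v)))
           (n≤1+n v) (⊔-idem (suc v))) ⟩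
      acceptedCount step120 m r (suc v) v d + acceptedCount step120 m r (suc v) (suc v) d
    ≡⟨ cong₂ _+_ (count120-below r v d (tail<bound bound ≤-refl)) (count120-top r v d (tail<bound-suc bound)) ⟩
      a (suc r) d
    ∎
    where
    open ≡-Reasoning
    open FirstLetter step120 m r (suc v) v d
  count120-top zero v d _ = acceptedCount-zero step120 m (suc v) (suc v) d
  count120-top (suc r) v d bound =
    begin
      acceptedCount step120 m (suc r) (suc v) (suc v) d
    ≡⟨ acceptedCount-suc ⟩
      ∑[ x < m ] startingWith x
    ≡⟨ ∑-truncate startingWith (next<bound bound)
         (λ x 3+v≤x → startingWith-reject x (step120-reject-high (suc v) (suc v) x 3+v≤x)) ⟩
      ∑[ x < v ] startingWith x + startingWith v + startingWith (suc v) + startingWith (2 + v)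
    ≡⟨ cong (λ n → n + startingWith v + startingWith (suc v) + startingWith (2 + v))
         (∑-zero v (λ x x<v → startingWith-reject x (step120-reject-low (suc v) (suc v) x (s≤s x<v)))) ⟩
      startingWith v + startingWith (suc v) + startingWith (2 + v)
    ≡⟨ cong₂ _+_ (cong₂ _+_
         (startingWith-descent v (step120-accept (suc v) (suc v) v (≤-trans (n≤1+n v) (n≤1+n (suc v))) ≤-refl)
           ≤-refl (m≥n⇒m⊔n≡m (n≤1+n v)))
         (startingWith-noDescent (suc v) (step120-accept (suc v) (suc v) (suc v) (n≤1+n (suc v)) (n≤1+n (suc v)))
           ≤-refl (⊔-idem (suc v))))
         (startingWith-noDescent (2 + v) (step120-accept (suc v) (suc v) (2 + v) ≤-refl (m≤n⇒m≤1+n (n≤1+n (suc v))))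
           (n≤1+n (suc v)) (m≤n⇒m⊔n≡n (n≤1+n (suc v)))) ⟩
      shiftY (acceptedCount step120 m r (suc v) v) d + acceptedCount step120 m r (suc v) (suc v) d
        + acceptedCount step120 m r (2 + v) (2 + v) d
    ≡⟨ cong₂ _+_ (cong₂ _+_
         (shiftY-cong (λ e → count120-below r v e (tail<bound {suc v} bound (n≤1+n v))) d)
         (count120-top r v d (tail<bound {suc v} bound ≤-refl)))
         (count120-top r (suc v) d (tail<bound-suc {suc v} bound)) ⟩
      shiftY (a r) d + b r d + b r d
    ≡⟨ trans (+-assoc (shiftY (a r) d) (b r d) (b r d)) (+-comm (shiftY (a r) d) (b r d + b r d)) ⟩
      b (suc r) d
    ∎
    where
    open ≡-Reasoning
    open FirstLetter step120 m r (suc v) (suc v) d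

step101-accept-fall : ∀ M v x → x ≤ v → step101 M v x ≡ true
step101-accept-fall M v x x≤v
  rewrite ≤⇒≤ᵇ′ (≤-trans x≤v (n≤1+n v)) | ≥⇒¬<ᵇ x≤v = cong not (∧-zeroʳ (v <ᵇ M))

step101-accept-peak : ∀ M v x → x ≤ suc v → M ≤ v → step101 M v x ≡ true
step101-accept-peak M v x x≤1+v M≤v rewrite ≤⇒≤ᵇ′ x≤1+v | ≥⇒¬<ᵇ M≤v = refl

step101-reject-high : ∀ M v x → suc v < x → step101 M v x ≡ false
step101-reject-high M v x 1+v<x rewrite >⇒¬≤ᵇ 1+v<x = refl

step101-reject-rise : ∀ M v x → v < M → v < x → step101 M v x ≡ false
step101-reject-rise M v x v<M v<x rewrite <⇒<ᵇ′ v<M | <⇒<ᵇ′ v<x = ∧-zeroʳ (x ≤ᵇ suc v)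

fall : ℕ → ℕ → ℕ → ℕ
fall zero v d = δ₀ d
fall (suc r) v d = fall r v d + shiftY (λ e → ∑[ x < v ] fall r x e) d

peak : ℕ → ℕ → ℕ → ℕ
peak zero v d = δ₀ d
peak (suc r) v d = (peak r v d + peak r (suc v) d) + shiftY (λ e → ∑[ x < v ] fall r x e) d

module _ (m : ℕ) where

  count101-fall : ∀ r M v d → v < M → v + r < m → acceptedCount step101 m r M v d ≡ fall r v d
  count101-fall zero M v d _ _ = acceptedCount-zero step101 m M v d
  count101-fall (suc r) M v d v<M bound =
    begin
      acceptedCount step101 m (suc r) M v d
    ≡⟨ acceptedCount-suc ⟩
      ∑[ x < m ] startingWith x
    ≡⟨ ∑-truncate startingWith (<⇒≤ (next<bound bound))
         (λ x 1+v≤x → startingWith-reject x (step101-reject-rise M v x v<M 1+v≤x)) ⟩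
      ∑[ x < v ] startingWith x + startingWith v
    ≡⟨ cong₂ _+_ (trans (∑-cong v lower) (∑-shiftY v (fall r) d))
         (trans (startingWith-noDescent v (step101-accept-fall M v v ≤-refl) ≤-refl (m≥n⇒m⊔n≡m (<⇒≤ v<M)))
           (count101-fall r M v d v<M (tail<bound bound ≤-refl))) ⟩
      shiftY (λ e → ∑[ x < v ] fall r x e) d + fall r v d
    ≡⟨ +-comm _ (fall r v d) ⟩
      fall (suc r) v d
    ∎
    where
    open ≡-Reasoning
    open FirstLetter step101 m r M v d
    lower : ∀ x → x < v → startingWith x ≡ shiftY (fall r x) d
    lower x x<v =
      trans (startingWith-descent x (step101-accept-fall M v x (<⇒≤ x<v)) x<v (m≥n⇒m⊔n≡m (<⇒≤ x<M)))
        (shiftY-cong (λ e → count101-fall r M x e x<M (tail<bound bound (<⇒≤ x<v))) d)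
      where
      x<M : x < M
      x<M = <-trans x<v v<M

  count101-peak : ∀ r v d → v + r < m → acceptedCount step101 m r v v d ≡ peak r v d
  count101-peak zero v d _ = acceptedCount-zero step101 m v v d
  count101-peak (suc r) v d bound =
    begin
      acceptedCount step101 m (suc r) v v d
    ≡⟨ acceptedCount-suc ⟩
      ∑[ x < m ] startingWith x
    ≡⟨ ∑-truncate startingWith (next<bound bound)
         (λ x 2+v≤x → startingWith-reject x (step101-reject-high v v x 2+v≤x)) ⟩
      ∑[ x < v ] startingWith x + startingWith v + startingWith (suc v)
    ≡⟨ cong₂ _+_ (cong₂ _+_ (trans (∑-cong v lower) (∑-shiftY v (fall r) d))
         (trans (startingWith-noDescent v (step101-accept-fall v v v ≤-refl) ≤-refl (⊔-idem v))
           (count101-peak r v d (tail<bound bound ≤-refl))))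
         (trans (startingWith-noDescent (suc v) (step101-accept-peak v v (suc v) ≤-refl ≤-refl) (n≤1+n v)
                  (m≤n⇒m⊔n≡n (n≤1+n v)))
           (count101-peak r (suc v) d (tail<bound-suc bound))) ⟩
      shiftY (λ e → ∑[ x < v ] fall r x e) d + peak r v d + peak r (suc v) d
    ≡⟨ trans (+-assoc (shiftY (λ e → ∑[ x < v ] fall r x e) d) (peak r v d) (peak r (suc v) d))
         (+-comm (shiftY (λ e → ∑[ x < v ] fall r x e) d) (peak r v d + peak r (suc v) d)) ⟩
      peak (suc r) v d
    ∎
    where
    open ≡-Reasoning
    open FirstLetter step101 m r v v d
    lower : ∀ x → x < v → startingWith x ≡ shiftY (fall r x) d
    lower x x<v =
      trans (startingWith-descent x (step101-accept-fall v v x (<⇒≤ x<v)) x<v (m≥n⇒m⊔n≡m (<⇒≤ x<v)))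
        (shiftY-cong (λ e → count101-fall r v x e x<v (tail<bound bound (<⇒≤ x<v))) d)

peak-shift : ∀ r v d → peak r (2 + v) d + shiftY (fall r v) d ≡ peak r (suc v) d + shiftY (peak r v) d
peak-shift zero v zero = refl
peak-shift zero v (suc d) = refl
peak-shift (suc r) v zero = cong (_+ 0) (cong (_+ 0) (cong₂ _+_
  (+-cancelʳ-≡ 0 (peak r (2 + v) 0) (peak r (suc v) 0) (peak-shift r v 0))
  (+-cancelʳ-≡ 0 (peak r (3 + v) 0) (peak r (2 + v) 0) (peak-shift r (suc v) 0))))
peak-shift (suc r) v (suc e) =
  begin
    ((x₂ + x₃) + (s + f₁)) + (f₀ + z)
  ≡⟨ solve 6 (λ x₂ x₃ s f₁ f₀ z → ((x₂ :+ x₃) :+ (s :+ f₁)) :+ (f₀ :+ z)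
                                  := ((x₃ :+ f₁) :+ (x₂ :+ f₀)) :+ (s :+ z)) refl x₂ x₃ s f₁ f₀ z ⟩
    ((x₃ + f₁) + (x₂ + f₀)) + (s + z)
  ≡⟨ cong₂ (λ p q → (p + q) + (s + z)) (peak-shift r (suc v) (suc e)) (peak-shift r v (suc e)) ⟩
    ((x₂ + y₁) + (x₁ + y₀)) + (s + z)
  ≡⟨ solve 6 (λ x₁ x₂ y₀ y₁ s z → ((x₂ :+ y₁) :+ (x₁ :+ y₀)) :+ (s :+ z)
                                  := ((x₁ :+ x₂) :+ s) :+ ((y₀ :+ y₁) :+ z)) refl x₁ x₂ y₀ y₁ s z ⟩
    ((x₁ + x₂) + s) + ((y₀ + y₁) + z)
  ∎
  where
  open ≡-Reasoning
  open +-*-Solver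
  x₁ x₂ x₃ y₀ y₁ s f₀ f₁ z : ℕ
  x₁ = peak r (suc v) (suc e)
  x₂ = peak r (2 + v) (suc e)
  x₃ = peak r (3 + v) (suc e)
  y₀ = peak r v e
  y₁ = peak r (suc v) e
  s = ∑[ x < suc v ] fall r x e
  f₀ = fall r v e
  f₁ = fall r (suc v) e
  z = shiftY (λ e′ → ∑[ x < v ] fall r x e′) e

peak-0≡a : ∀ r d → peak r 0 d ≡ a r d
peak-1≡b : ∀ r d → peak r 1 d ≡ b r d

peak-0≡a zero d = refl
peak-0≡a (suc r) zero = trans (+-identityʳ _) (cong₂ _+_ (peak-0≡a r 0) (peak-1≡b r 0))
peak-0≡a (suc r) (suc d) = trans (+-identityʳ _) (cong₂ _+_ (peak-0≡a r (suc d)) (peak-1≡b r (suc d)))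

peak-1≡b zero d = refl
peak-1≡b (suc r) d =
  begin
    (peak r 1 d + peak r 2 d) + shiftY (fall r 0) d
  ≡⟨ +-assoc (peak r 1 d) (peak r 2 d) _ ⟩
    peak r 1 d + (peak r 2 d + shiftY (fall r 0) d)
  ≡⟨ cong (_+_ (peak r 1 d)) (peak-shift r 0 d) ⟩
    peak r 1 d + (peak r 1 d + shiftY (peak r 0) d)
  ≡⟨ sym (+-assoc (peak r 1 d) (peak r 1 d) _) ⟩
    (peak r 1 d + peak r 1 d) + shiftY (peak r 0) d
  ≡⟨ cong₂ (λ p q → (p + p) + q) (peak-1≡b r d) (shiftY-cong (peak-0≡a r) d) ⟩
    b (suc r) d
  ∎
  where open ≡-Reasoning

c-as-count : ∀ p n k → c p n k ≡ count (λ w → isCatalan w ∧ (avoids w p ∧ (des w ≡ᵇ k))) (words n n)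
c-as-count p n k = trans (length-filter≡count _ (filter (λ w → isCatalan w ≟ᵇ true) (words n n)))
  (count-filter isCatalan (λ w → avoids w p ∧ (des w ≡ᵇ k)) (words n n))

c-suc : ∀ p r k {G : List ℕ → Bool} →
  (∀ s → isCatalanFrom 0 s ∧ (avoids (0 ∷ s) p ∧ (des (0 ∷ s) ≡ᵇ k)) ≡ G s) →
  c p (suc r) k ≡ count G (words r (suc r))
c-suc p r k {G} first0 =
  begin
    c p (suc r) k
  ≡⟨ c-as-count p (suc r) k ⟩
    count P (words (suc r) (suc r))
  ≡⟨ count-words-suc P r (suc r) ⟩
    ∑[ x < suc r ] count (λ s → P (x ∷ s)) (words r (suc r))
  ≡⟨ ∑-suc r _ ⟩
    count (λ s → P (0 ∷ s)) (words r (suc r)) + ∑[ x < r ] count (λ s → P (suc x ∷ s)) (words r (suc r))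
  ≡⟨ cong₂ _+_ (count-cong first0 (words r (suc r))) (∑-zero r (λ x _ → count-false (words r (suc r)))) ⟩
    count G (words r (suc r)) + 0
  ≡⟨ +-identityʳ _ ⟩
    count G (words r (suc r))
  ∎
  where
  open ≡-Reasoning
  P : List ℕ → Bool
  P w = isCatalan w ∧ (avoids w p ∧ (des w ≡ᵇ k))

noneTwoBelow : ∀ M → M ≤ 1 → ∀ s → hasSubseq 1 (twoBelow M) s ≡ false
noneTwoBelow M M≤1 = hasSubseq-false 1 none
  where
  none : ∀ t → twoBelow M t ≡ false
  none [] = refl
  none (z ∷ _) = >⇒¬≤ᵇ (s≤s (≤-trans M≤1 (s≤s z≤n)))

-- Running maximum 1 instead of 0 is harmless, as no letter lies two below 1, and puts the
-- initial 0 into the state "one below the maximum".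
avoids120≡accepts : ∀ k s → isCatalanFrom 0 s ∧ (avoids (0 ∷ s) p120 ∧ (des (0 ∷ s) ≡ᵇ k))
                            ≡ accepts step120 1 0 s ∧ (des (0 ∷ s) ≡ᵇ k)
avoids120≡accepts k s rewrite accepts-step120 1 0 s with isCatalanFrom 0 s in catalan
... | false = refl
... | true rewrite contains-120 s catalan | noneTwoBelow 0 z≤n s | noneTwoBelow 1 ≤-refl s = refl

avoids101≡accepts : ∀ k s → isCatalanFrom 0 s ∧ (avoids (0 ∷ s) p101 ∧ (des (0 ∷ s) ≡ᵇ k))
                            ≡ accepts step101 0 0 s ∧ (des (0 ∷ s) ≡ᵇ k)
avoids101≡accepts k s rewrite accepts-step101 0 0 s with isCatalanFrom 0 s in catalan
... | false = refl
... | true rewrite contains-101 s catalan | hasValleyFrom-0 (0 ∷ s) | hasValleyFrom-0 s = refl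

c120 : ∀ r k → c p120 (suc r) k ≡ a r k
c120 r k = trans (c-suc p120 r k (avoids120≡accepts k)) (count120-below (suc r) r 0 k ≤-refl)

c101 : ∀ r k → c p101 (suc r) k ≡ a r k
c101 r k = trans (c-suc p101 r k (avoids101≡accepts k)) (trans (count101-peak (suc r) r 0 k ≤-refl) (peak-0≡a r k))

-- The generating function

a-recurrence : ∀ r d → a (2 + r) d + (a r d + a r d) ≡ a (suc r) d + a (suc r) d + a (suc r) d + shiftY (a r) d
a-recurrence r d =
  solve 3 (λ x y z → ((x :+ y) :+ ((y :+ y) :+ z)) :+ (x :+ x) := (x :+ y) :+ (x :+ y) :+ (x :+ y) :+ z)
    refl (a r d) (b r d) (shiftY (a r) d)
  where open +-*-Solver

-- The left side is the coefficient of x^(r+3) y^k in denom · avoiderSeries, as polyMul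
-- unfolds it, with x, y, z, w the values of a at (r+2, k), (r, k), (r+1, k), (r, k-1)
-- (w = 0 when k = 0).
denominator-annihilates : ∀ x y z w → x + (y + y) ≡ z + z + z + w →
  + 1 ℤ.* + x ℤ.+ (-[1+ 2 ] ℤ.* + z ℤ.+ (+ 2 ℤ.* + y ℤ.+ (-[1+ 0 ] ℤ.* + w ℤ.+ + 0))) ≡ + 0
denominator-annihilates x y z w eq =
  begin
    + 1 ℤ.* + x ℤ.+ (-[1+ 2 ] ℤ.* + z ℤ.+ (+ 2 ℤ.* + y ℤ.+ (-[1+ 0 ] ℤ.* + w ℤ.+ + 0)))
  ≡⟨ solve 4 (λ x y z w → con (+ 1) :* x :+ (con -[1+ 2 ] :* z :+ (con (+ 2) :* y :+ (con -[1+ 0 ] :* w :+ con (+ 0))))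
                          := (x :+ (y :+ y)) :- (z :+ z :+ z :+ w)) refl (+ x) (+ y) (+ z) (+ w) ⟩
    (+ x ℤ.+ (+ y ℤ.+ + y)) ℤ.- (+ z ℤ.+ + z ℤ.+ + z ℤ.+ + w)
  ≡⟨ cong₂ ℤ._-_ (sym (trans (pos-+ x (y + y)) (cong (ℤ._+_ (+ x)) (pos-+ y y))))
       (sym (trans (pos-+ (z + z + z) w) (cong (ℤ._+ + w) (trans (pos-+ (z + z) z) (cong (ℤ._+ + z) (pos-+ z z)))))) ⟩
    + (x + (y + y)) ℤ.- + (z + z + z + w)
  ≡⟨ cong (λ n → + n ℤ.- + (z + z + z + w)) eq ⟩
    + (z + z + z + w) ℤ.- + (z + z + z + w)
  ≡⟨ ℤ.+-inverseʳ (+ (z + z + z + w)) ⟩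
    + 0
  ∎
  where
  open ≡-Reasoning
  open ℤ-Solver.+-*-Solver

avoiderSeries : Series
avoiderSeries zero k = + δ₀ k
avoiderSeries (suc r) k = + a r k

avoiderSeries-rational : ∀ n k → polyMul denom avoiderSeries n k ≡ polyCoeff numer n k
avoiderSeries-rational 0 zero = refl
avoiderSeries-rational 0 (suc k) = refl
avoiderSeries-rational 1 zero = refl
avoiderSeries-rational 1 (suc k) = refl
avoiderSeries-rational 2 zero = refl
avoiderSeries-rational 2 1 = refl
avoiderSeries-rational 2 (suc (suc k)) = refl
avoiderSeries-rational (suc (suc (suc r))) zero =
  denominator-annihilates (a (2 + r) 0) (a r 0) (a (suc r) 0) 0 (a-recurrence r 0)
avoiderSeries-rational (suc (suc (suc r))) (suc k) =
  denominator-annihilates (a (2 + r) (suc k)) (a r (suc k)) (a (suc r) (suc k)) (a r k) (a-recurrence r (suc k))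

polyMul-cong : ∀ P {f g : Series} → (∀ n k → f n k ≡ g n k) → ∀ n k → polyMul P f n k ≡ polyMul P g n k
polyMul-cong [] f≡g n k = refl
polyMul-cong ((i , j , _) ∷ P) f≡g n k rewrite f≡g (n ∸ i) (k ∸ j) | polyMul-cong P f≡g n k = refl

rational-if-counted-by-a : ∀ p → (∀ k → c p 0 k ≡ δ₀ k) → (∀ r k → c p (suc r) k ≡ a r k) →
  ∀ n k → polyMul denom (C p) n k ≡ polyCoeff numer n k
rational-if-counted-by-a p counts-empty counts-suc n k =
  trans (polyMul-cong denom C≡avoiderSeries n k) (avoiderSeries-rational n k)
  where
  C≡avoiderSeries : ∀ n k → C p n k ≡ avoiderSeries n k
  C≡avoiderSeries zero k = cong +_ (counts-empty k)
  C≡avoiderSeries (suc r) k = cong +_ (counts-suc r k)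

theorem8 : (p : List ℕ) → p ≡ p120 ⊎ p ≡ p101 →
    (n k : ℕ) → polyMul denom (C p) n k ≡ polyCoeff numer n k
theorem8 p (inj₁ refl) = rational-if-counted-by-a p120 (λ { zero → refl ; (suc _) → refl }) c120
theorem8 p (inj₂ refl) = rational-if-counted-by-a p101 (λ { zero → refl ; (suc _) → refl }) c101
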